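{- Let $\alpha\in(0,1)$ be irrational and let $n,n'\ge1$ with $k_0(n)=k_0(n')=L$, where $L\ge2$ (or $L\ge1$ if $\alpha<1/2$). Let $|\cdot|_{\mathrm{side}}\in\{|\cdot|_{\mathrm{left}},|\cdot|_{\mathrm{right}}\}$ be chosen so that $|n\alpha|_{\mathrm{side}}=\|n\alpha\|$. If $b_L(n)<b_L(n')$, then $|n\alpha|_{\mathrm{side}}<|n'\alpha|_{\mathrm{side}}$.
   Context: $\{x\}=x-\lfloor x\rfloor$, $\|x\|$ is the distance from $x$ to the nearest integer, $|\xi|_{\mathrm{left}}:=\{\xi\}$ and $|\xi|_{\mathrm{right}}:=\{ -\xi\}$. Let $\alpha=[0;a_1,a_2,\dots]$, $q_0=1$, $q_1=a_1$, $q_{k+1}=a_{k+1}q_k+q_{k-1}$. Every positive integer $n$ has a unique Ostrowski representation $n=\sum_{k=0}^N b_kq_k$ with $0\le b_0\le a_1-1$, $0\le b_k\le a_{k+1}$ ($k\ge1$), and $b_{k-1}=0$ whenever $b_k=a_{k+1}$; $b_k(n)$ denotes $b_k$ and $k_0(n)=\min\{k:b_k(n)>0\}$. -}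

module Defs where

open import Data.Nat as ℕ using (ℕ; zero; suc)
open import Data.Integer as ℤ using (ℤ; +_; -_; _-_)
open import Data.Product using (Σ; ∃; _×_; _,_)
open import Data.Sum using (_⊎_)
open import Relation.Nullary using (¬_)
open import Relation.Binary.PropositionalEquality using (_≡_)

-- A sequence  a : ℕ → ℕ  with  a (suc k) ≥ 1
-- encodes the irrational α = [0; a 1, a 2, ...] ∈ (0,1)  (a 0 is unused).
-- Every irrational α ∈ (0,1) arises this way, uniquely.

CFSeq : (ℕ → ℕ) → Set
CFSeq a = ∀ k → 1 ℕ.≤ a (suc k)

q : (ℕ → ℕ) → ℕ → ℕ
q a zero = 1
q a (suc zero) = a 1
q a (suc (suc k)) = a (suc (suc k)) ℕ.* q a (suc k) ℕ.+ q a k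

p : (ℕ → ℕ) → ℕ → ℕ
p a zero = 0
p a (suc zero) = 1
p a (suc (suc k)) = a (suc (suc k)) ℕ.* p a (suc k) ℕ.+ p a k

-- Real numbers of the form  x·α + y  (x y : ℤ).  α is the real number
-- determined by its convergents: the even convergents p_{2k}/q_{2k}
-- increase to α and the odd ones p_{2k+1}/q_{2k+1} decrease to α, i.e.
--   r < α  ⇔  ∃ k. r < p_{2k}/q_{2k}      α < r  ⇔  ∃ k. p_{2k+1}/q_{2k+1} < r.

record Lin : Set where
  constructor _α+_
  field
    coef : ℤ
    cst  : ℤ
open Lin public

-- value of x·α + y at the convergent p_k / q_k, times q_k
atConv : (ℕ → ℕ) → Lin → ℕ → ℤ
atConv a (x α+ y) k = x ℤ.* + p a k ℤ.+ y ℤ.* + q a k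

-- 0 < x·α + y   (case split on the sign of x, using the Dedekind cut of α)
Pos : (ℕ → ℕ) → Lin → Set
Pos a (x α+ y) =
    (x ≡ + 0 × ℤ.+ 0 ℤ.< y)
  ⊎ (ℤ.+ 0 ℤ.< x × ∃ λ k → ℤ.+ 0 ℤ.< atConv a (x α+ y) (2 ℕ.* k))        -- α > -y/x
  ⊎ (x ℤ.< ℤ.+ 0 × ∃ λ k → ℤ.+ 0 ℤ.< atConv a (x α+ y) (suc (2 ℕ.* k)))  -- α < -y/x

_⊖_ : Lin → Lin → Lin
(x α+ y) ⊖ (x' α+ y') = (x - x') α+ (y - y')

neg : Lin → Lin
neg (x α+ y) = (- x) α+ (- y)

const : ℤ → Lin
const m = (+ 0) α+ m

_<[_]_ : Lin → (ℕ → ℕ) → Lin → Set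
ξ <[ a ] η = Pos a (η ⊖ ξ)

_≤[_]_ : Lin → (ℕ → ℕ) → Lin → Set
ξ ≤[ a ] η = ¬ (η <[ a ] ξ)

_≈[_]_ : Lin → (ℕ → ℕ) → Lin → Set
ξ ≈[ a ] η = (ξ ≤[ a ] η) × (η ≤[ a ] ξ)

IsFloor : (ℕ → ℕ) → Lin → ℤ → Set
IsFloor a ξ m = (const m <[ a ] ξ) × (ξ <[ a ] const (m ℤ.+ + 1))

frac : Lin → ℤ → Lin
frac ξ m = ξ ⊖ const m

IsMin : (ℕ → ℕ) → Lin → Lin → Lin → Set
IsMin a A B X = ((A ≤[ a ] B) × (X ≈[ a ] A)) ⊎ ((B <[ a ] A) × (X ≈[ a ] B))

-- X = ‖ξ‖ = min({ξ}, 1 - {ξ}) (distance to nearest integer), m = ⌊ξ⌋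
IsDist : (ℕ → ℕ) → Lin → ℤ → Lin → Set
IsDist a ξ m X = IsMin a (frac ξ m) (const (m ℤ.+ + 1) ⊖ ξ) X

nα : ℕ → Lin
nα n = (+ n) α+ (+ 0)

-- the two one-sided distances:  |ξ|_left = {ξ},  |ξ|_right = {-ξ}
data Side : Set where
  left right : Side

sideArg : Side → Lin → Lin
sideArg left  ξ = ξ
sideArg right ξ = neg ξ

sideVal : Side → Lin → ℤ → Lin
sideVal s ξ m = frac (sideArg s ξ) m

sumTo : (ℕ → ℕ) → ℕ → ℕ
sumTo f zero = f 0
sumTo f (suc N) = sumTo f N ℕ.+ f (suc N)

Ostrowski : (ℕ → ℕ) → ℕ → (ℕ → ℕ) → Set
Ostrowski a n b =
    (∃ λ N → (∀ k → N ℕ.< k → b k ≡ 0) × (n ≡ sumTo (λ k → b k ℕ.* q a k) N))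
  × (b 0 ℕ.< a 1)
  × (∀ k → b (suc k) ℕ.≤ a (suc (suc k)))
  × (∀ k → b (suc k) ≡ a (suc (suc k)) → b k ≡ 0)

K0 : (ℕ → ℕ) → ℕ → Set
K0 b L = (0 ℕ.< b L) × (∀ k → k ℕ.< L → b k ≡ 0)

{-# OPTIONS --safe #-}
module Submission where

-- A real xα + y is positive iff x p_i + y q_i > 0 at all large convergents p_i/q_i, so
-- everything is decided at a single large level i.  With P = Σ b_k p_k the digit expansion
-- gives n p_i - P q_i = (-1)^L V, where V = Σ_{k ≥ L} (-1)^(k-L) b_k t_k and the
-- t_k = (-1)^k (q_k p_i - p_k q_i) are positive and satisfy t_k = a_{k+2} t_{k+1} + t_{k+2}.
-- The Ostrowski digit conditions put V strictly between 0 and q_i/2 (for L = 1 through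
-- 2 p_i < q_i, i.e. α < 1/2) and make V strictly increasing in the leading digit b_L.
-- Hence nα lies within 1/2 of P, above P for even L and below it for odd L.  Only the side
-- matching the parity of L can realise ‖nα‖, and on that side |nα|_side is V/q_i at level
-- i, so comparing |nα|_side with |n'α|_side is comparing V(n) with V(n').

open import Data.Empty using (⊥; ⊥-elim)
open import Data.Nat as ℕ using (ℕ; zero; suc; z≤n; s≤s; _≤′_; ≤′-refl; ≤′-step; _≤‴_; ≤‴-refl; ≤‴-step)
import Data.Nat.Properties as ℕₚ
open import Data.Integer as ℤ using (ℤ; +_; -_; _+_; _-_; _*_; 0ℤ; 1ℤ; -1ℤ; +<+; +≤+; -<+; -[1+_]; +[1+_])
import Data.Integer.Properties as ℤₚ
open import Data.Integer.Tactic.RingSolver using (solve-∀)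
open import Data.Product using (∃; _×_; _,_; proj₁; proj₂)
open import Data.Sum using (_⊎_; inj₁; inj₂; [_,_]′)
open import Function using (_∘_)
open import Relation.Binary.PropositionalEquality

open import Defs

sign : ℕ → ℤ
sign zero    = 1ℤ
sign (suc k) = - sign k

sign-squared : ∀ k → sign k * sign k ≡ 1ℤ
sign-squared zero    = refl
sign-squared (suc k) = trans (neg*neg (sign k)) (sign-squared k)
  where neg*neg : ∀ s → - s * - s ≡ s * s
        neg*neg = solve-∀

sign-even : ∀ k → sign (2 ℕ.* k) ≡ 1ℤ
sign-even zero    = refl
sign-even (suc k) rewrite ℕₚ.+-suc k (k ℕ.+ 0) =
  trans (ℤₚ.neg-involutive (sign (2 ℕ.* k))) (sign-even k)

sign-cases : ∀ k → sign k ≡ 1ℤ ⊎ sign k ≡ -1ℤ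
sign-cases zero = inj₁ refl
sign-cases (suc k) with sign-cases k
... | inj₁ eq = inj₂ (cong -_ eq)
... | inj₂ eq = inj₁ (cong -_ eq)

sideSign : Side → ℤ
sideSign left  = 1ℤ
sideSign right = -1ℤ

sideSign-cancel : ∀ s x → sideSign s * (sideSign s * x) ≡ x
sideSign-cancel left  = solve-∀
sideSign-cancel right = solve-∀

sideSign-flip : ∀ s x → sideSign s * (- sideSign s * x) ≡ - x
sideSign-flip left  = solve-∀
sideSign-flip right = solve-∀

sign-vs-side : ∀ k s → sign k ≡ sideSign s ⊎ sign k ≡ - sideSign s
sign-vs-side k left  = sign-cases k
sign-vs-side k right with sign-cases k
... | inj₁ eq = inj₂ eq
... | inj₂ eq = inj₁ eq

record Eventually (P : ℕ → Set) : Set where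
  constructor after
  field
    start : ℕ
    holds : ∀ i → start ℕ.≤ i → P i

eventually-map : ∀ {P Q : ℕ → Set} → (∀ {i} → P i → Q i) → Eventually P → Eventually Q
eventually-map f (after K h) = after K λ i K≤i → f (h i K≤i)

eventually-zip : ∀ {P Q : ℕ → Set} → Eventually P → Eventually Q → Eventually (λ i → P i × Q i)
eventually-zip (after K h) (after K′ h′) =
  after (K ℕ.⊔ K′) λ i K⊔K′≤i → h i (ℕₚ.m⊔n≤o⇒m≤o K K′ K⊔K′≤i) , h′ i (ℕₚ.m⊔n≤o⇒n≤o K K′ K⊔K′≤i)

eventually-ap : ∀ {P Q : ℕ → Set} → Eventually (λ i → P i → Q i) → Eventually P → Eventually Q
eventually-ap ev-P⇒Q ev-P = eventually-map (λ (P⇒Qᵢ , Pᵢ) → P⇒Qᵢ Pᵢ) (eventually-zip ev-P⇒Q ev-P)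

eventually⇒∃ : ∀ {P : ℕ → Set} → Eventually P → ∃ P
eventually⇒∃ (after K h) = K , h K ℕₚ.≤-refl

eventually-shift : ∀ {P : ℕ → Set} → Eventually (λ r → P (suc r)) → Eventually P
eventually-shift (after K h) = after (suc K) λ { (suc r) (s≤s K≤r) → h r K≤r }

alt : (ℕ → ℤ) → ℕ → ℕ → ℤ
alt u j zero    = 0ℤ
alt u j (suc f) = u j - alt u (suc j) f

sumFrom : (ℕ → ℤ) → ℕ → ℕ → ℤ
sumFrom g j zero    = 0ℤ
sumFrom g j (suc f) = g j + sumFrom g (suc j) f

sumFrom-snoc : ∀ g j f → sumFrom g j (suc f) ≡ sumFrom g j f + g (j ℕ.+ f)
sumFrom-snoc g j zero = begin
  g j + 0ℤ           ≡⟨ ℤₚ.+-identityʳ (g j) ⟩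
  g j                ≡⟨ cong g (sym (ℕₚ.+-identityʳ j)) ⟩
  g (j ℕ.+ 0)        ≡⟨ sym (ℤₚ.+-identityˡ _) ⟩
  0ℤ + g (j ℕ.+ 0)   ∎
  where open ≡-Reasoning
sumFrom-snoc g j (suc f) = begin
  g j + sumFrom g (suc j) (suc f)                 ≡⟨ cong (λ x → g j + x) (sumFrom-snoc g (suc j) f) ⟩
  g j + (sumFrom g (suc j) f + g (suc j ℕ.+ f))   ≡⟨ sym (ℤₚ.+-assoc (g j) _ _) ⟩
  g j + sumFrom g (suc j) f + g (suc j ℕ.+ f)     ≡⟨ cong (λ k → g j + sumFrom g (suc j) f + g k) (sym (ℕₚ.+-suc j f)) ⟩
  g j + sumFrom g (suc j) f + g (j ℕ.+ suc f)     ∎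
  where open ≡-Reasoning

sumFrom-skip-zeros : ∀ g i j f → (∀ k → k ℕ.< j ℕ.+ i → g k ≡ 0ℤ) → sumFrom g i (j ℕ.+ f) ≡ sumFrom g (j ℕ.+ i) f
sumFrom-skip-zeros g i zero    f _     = refl
sumFrom-skip-zeros g i (suc j) f zeros = begin
  g i + sumFrom g (suc i) (j ℕ.+ f)   ≡⟨ cong₂ ℤ._+_ (zeros i (ℕₚ.m<n+m i (s≤s z≤n))) (sumFrom-skip-zeros g (suc i) j f zeros′) ⟩
  0ℤ + sumFrom g (j ℕ.+ suc i) f      ≡⟨ ℤₚ.+-identityˡ _ ⟩
  sumFrom g (j ℕ.+ suc i) f           ≡⟨ cong (λ k → sumFrom g k f) (ℕₚ.+-suc j i) ⟩
  sumFrom g (suc j ℕ.+ i) f           ∎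
  where
    open ≡-Reasoning
    zeros′ : ∀ k → k ℕ.< j ℕ.+ suc i → g k ≡ 0ℤ
    zeros′ k k<j+i+1 = zeros k (subst (k ℕ.<_) (ℕₚ.+-suc j i) k<j+i+1)

sumFrom-alternating : ∀ g u j f → (∀ k → g k ≡ sign k * u k) → sumFrom g j f ≡ sign j * alt u j f
sumFrom-alternating g u j zero    _  = sym (ℤₚ.*-zeroʳ (sign j))
sumFrom-alternating g u j (suc f) g≡ = begin
  g j + sumFrom g (suc j) f                       ≡⟨ cong₂ ℤ._+_ (g≡ j) (sumFrom-alternating g u (suc j) f g≡) ⟩
  sign j * u j + - sign j * alt u (suc j) f       ≡⟨ factor (sign j) (u j) (alt u (suc j) f) ⟩
  sign j * (u j - alt u (suc j) f)                ∎
  where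
    open ≡-Reasoning
    factor : ∀ s x y → s * x + - s * y ≡ s * (x - y)
    factor = solve-∀

module _ where
  open import Data.Integer using (_<_; _≤_)

  pos+nonNeg⇒pos : ∀ {i j} → 0ℤ < i → 0ℤ ≤ j → 0ℤ < i + j
  pos+nonNeg⇒pos {+[1+ m ]} {+ n} (+<+ (s≤s _)) (+≤+ _) = +<+ (s≤s z≤n)

  nonNeg+pos⇒pos : ∀ {i j} → 0ℤ ≤ i → 0ℤ < j → 0ℤ < i + j
  nonNeg+pos⇒pos {i} {j} 0≤i 0<j = subst (0ℤ <_) (ℤₚ.+-comm j i) (pos+nonNeg⇒pos 0<j 0≤i)

  pos*pos⇒pos : ∀ {i j} → 0ℤ < i → 0ℤ < j → 0ℤ < i * j
  pos*pos⇒pos (+<+ (s≤s _)) (+<+ (s≤s _)) = +<+ (s≤s z≤n)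

  nonNeg*nonNeg⇒nonNeg : ∀ {i j} → 0ℤ ≤ i → 0ℤ ≤ j → 0ℤ ≤ i * j
  nonNeg*nonNeg⇒nonNeg {+ m} {+ n} _ _ = subst (0ℤ ≤_) (ℤₚ.pos-* m n) (+≤+ z≤n)

  i<j⇒0<j-i : ∀ {i j} → i < j → 0ℤ < j - i
  i<j⇒0<j-i {i} {j} i<j = subst (_< j - i) (ℤₚ.+-inverseʳ i) (ℤₚ.+-monoˡ-< (- i) i<j)

  0<j-i⇒i<j : ∀ {i j} → 0ℤ < j - i → i < j
  0<j-i⇒i<j {i} {j} 0<j-i = subst₂ _<_ (ℤₚ.+-identityʳ i) (i+[j-i]≡j i j) (ℤₚ.+-monoʳ-< i 0<j-i)
    where i+[j-i]≡j : ∀ i j → i + (j - i) ≡ j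
          i+[j-i]≡j = solve-∀

  i+j<k⇒j<k-i : ∀ {i j k} → i + j < k → j < k - i
  i+j<k⇒j<k-i {i} {j} {k} i+j<k = subst (_< k - i) (cancel i j) (ℤₚ.+-monoˡ-< (- i) i+j<k)
    where cancel : ∀ i j → i + j - i ≡ j
          cancel = solve-∀

  neg-flip-< : ∀ {i j} → - i < j → - j < i
  neg-flip-< {i} {j} -i<j = subst (- j <_) (ℤₚ.neg-involutive i) (ℤₚ.neg-mono-< -i<j)

  0<i⇒i<2i : ∀ {i} → 0ℤ < i → i < + 2 * i
  0<i⇒i<2i {i} 0<i = subst₂ _<_ (ℤₚ.+-identityʳ i) (two-times i) (ℤₚ.+-monoʳ-< i 0<i)
    where two-times : ∀ i → i + i ≡ + 2 * i
          two-times = solve-∀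

  2i<j⇒i<j-i : ∀ {i j} → + 2 * i < j → i < j - i
  2i<j⇒i<j-i {i} 2i<j = i+j<k⇒j<k-i (subst (_< _) (two-times i) 2i<j)
    where two-times : ∀ i → + 2 * i ≡ i + i
          two-times = solve-∀

  0<i⇒j-i<j : ∀ {i j} → 0ℤ < i → j - i < j
  0<i⇒j-i<j {i} {j} 0<i = subst (j - i <_) (ℤₚ.+-identityʳ j) (ℤₚ.+-monoʳ-< j (ℤₚ.neg-mono-< 0<i))

  <+1∧>-1⇒≡ : ∀ {i j} → i < j + 1ℤ → j < i + 1ℤ → i ≡ j
  <+1∧>-1⇒≡ i<j+1 j<i+1 = ℤₚ.≤-antisym (<+1⇒≤ i<j+1) (<+1⇒≤ j<i+1)
    where <+1⇒≤ : ∀ {i j} → i < j + 1ℤ → i ≤ j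
          <+1⇒≤ {i} {j} i<j+1 = subst (i ≤_) (pred[j+1]≡j j) (ℤₚ.i<j⇒i≤pred[j] i<j+1)
            where pred[j+1]≡j : ∀ j → -1ℤ + (j + 1ℤ) ≡ j
                  pred[j+1]≡j = solve-∀

module _ (a : ℕ → ℕ) where
  open import Data.Integer using (_<_; _≤_)

  p-rec : ∀ k → + p a (suc (suc k)) ≡ + a (suc (suc k)) * + p a (suc k) + + p a k
  p-rec k = trans (ℤₚ.pos-+ _ (p a k)) (cong (_+ + p a k) (ℤₚ.pos-* (a (suc (suc k))) (p a (suc k))))

  q-rec : ∀ k → + q a (suc (suc k)) ≡ + a (suc (suc k)) * + q a (suc k) + + q a k
  q-rec k = trans (ℤₚ.pos-+ _ (q a k)) (cong (_+ + q a k) (ℤₚ.pos-* (a (suc (suc k))) (q a (suc k))))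

  convergent-det : ∀ k → + p a (suc k) * + q a k - + p a k * + q a (suc k) ≡ sign k
  convergent-det zero    = refl
  convergent-det (suc k) = begin
      + p a (suc (suc k)) * + q a (suc k) - + p a (suc k) * + q a (suc (suc k))
    ≡⟨ cong₂ (λ u v → u * + q a (suc k) - + p a (suc k) * v) (p-rec k) (q-rec k) ⟩
      (+ a (suc (suc k)) * + p a (suc k) + + p a k) * + q a (suc k)
        - + p a (suc k) * (+ a (suc (suc k)) * + q a (suc k) + + q a k)
    ≡⟨ det-step (+ a (suc (suc k))) (+ p a k) (+ p a (suc k)) (+ q a k) (+ q a (suc k)) ⟩
      - (+ p a (suc k) * + q a k - + p a k * + q a (suc k))
    ≡⟨ cong -_ (convergent-det k) ⟩
      sign (suc k) ∎
    where
      open ≡-Reasoning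
      det-step : ∀ A p₀ p₁ q₀ q₁ → (A * p₁ + p₀) * q₁ - p₁ * (A * q₁ + q₀) ≡ - (p₁ * q₀ - p₀ * q₁)
      det-step = solve-∀

  atConv-rec : ∀ ξ j → atConv a ξ (suc (suc j)) ≡ + a (suc (suc j)) * atConv a ξ (suc j) + atConv a ξ j
  atConv-rec (x α+ y) j = begin
      x * + p a (suc (suc j)) + y * + q a (suc (suc j))
    ≡⟨ cong₂ (λ u v → x * u + y * v) (p-rec j) (q-rec j) ⟩
      x * (A * p₁ + p₀) + y * (A * q₁ + q₀)
    ≡⟨ regroup x y A p₀ p₁ q₀ q₁ ⟩
      A * (x * p₁ + y * q₁) + (x * p₀ + y * q₀) ∎
    where
      open ≡-Reasoning
      A = + a (suc (suc j))
      p₀ = + p a j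
      p₁ = + p a (suc j)
      q₀ = + q a j
      q₁ = + q a (suc j)
      regroup : ∀ x y A p₀ p₁ q₀ q₁ →
        x * (A * p₁ + p₀) + y * (A * q₁ + q₀) ≡ A * (x * p₁ + y * q₁) + (x * p₀ + y * q₀)
      regroup = solve-∀

  atConv-cross : ∀ ξ j → atConv a ξ (suc j) * + q a j ≡ atConv a ξ j * + q a (suc j) + coef ξ * sign j
  atConv-cross (x α+ y) j = begin
      (x * p₁ + y * q₁) * q₀
    ≡⟨ regroup x y p₀ p₁ q₀ q₁ ⟩
      (x * p₀ + y * q₀) * q₁ + x * (p₁ * q₀ - p₀ * q₁)
    ≡⟨ cong (λ d → (x * p₀ + y * q₀) * q₁ + x * d) (convergent-det j) ⟩
      (x * p₀ + y * q₀) * q₁ + x * sign j ∎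
    where
      open ≡-Reasoning
      p₀ = + p a j
      p₁ = + p a (suc j)
      q₀ = + q a j
      q₁ = + q a (suc j)
      regroup : ∀ x y p₀ p₁ q₀ q₁ →
        (x * p₁ + y * q₁) * q₀ ≡ (x * p₀ + y * q₀) * q₁ + x * (p₁ * q₀ - p₀ * q₁)
      regroup = solve-∀

  atConv-⊖ : ∀ ξ η i → atConv a (ξ ⊖ η) i ≡ atConv a ξ i - atConv a η i
  atConv-⊖ (x α+ y) (x′ α+ y′) i = distrib x y x′ y′ (+ p a i) (+ q a i)
    where distrib : ∀ x y x′ y′ P Q → (x - x′) * P + (y - y′) * Q ≡ (x * P + y * Q) - (x′ * P + y′ * Q)
          distrib = solve-∀

  atConv-neg : ∀ ξ i → atConv a (neg ξ) i ≡ - atConv a ξ i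
  atConv-neg (x α+ y) i = distrib x y (+ p a i) (+ q a i)
    where distrib : ∀ x y P Q → - x * P + - y * Q ≡ - (x * P + y * Q)
          distrib = solve-∀

  atConv-const : ∀ c i → atConv a (const c) i ≡ c * + q a i
  atConv-const c i = ℤₚ.+-identityˡ (c * + q a i)

  atConv-nα : ∀ n i → atConv a (nα n) i ≡ + n * + p a i
  atConv-nα n i = ℤₚ.+-identityʳ (+ n * + p a i)

  atConv-sideArg : ∀ s ξ i → atConv a (sideArg s ξ) i ≡ sideSign s * atConv a ξ i
  atConv-sideArg left  ξ i = sym (ℤₚ.*-identityˡ (atConv a ξ i))
  atConv-sideArg right ξ i = trans (atConv-neg ξ i) (sym (ℤₚ.-1*i≡-i (atConv a ξ i)))

  atConv-digitSum : ∀ ξ (b : ℕ → ℕ) N →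
    sumFrom (λ k → + b k * atConv a ξ k) 0 (suc N)
      ≡ coef ξ * + sumTo (λ k → b k ℕ.* p a k) N + cst ξ * + sumTo (λ k → b k ℕ.* q a k) N
  atConv-digitSum (x α+ y) b zero = begin
      + b 0 * (x * 0ℤ + y * 1ℤ) + 0ℤ
    ≡⟨ regroup x y (+ b 0) ⟩
      x * (+ b 0 * 0ℤ) + y * (+ b 0 * 1ℤ)
    ≡⟨ sym (cong₂ (λ u v → x * u + y * v) (ℤₚ.pos-* (b 0) 0) (ℤₚ.pos-* (b 0) 1)) ⟩
      x * + (b 0 ℕ.* 0) + y * + (b 0 ℕ.* 1) ∎
    where
      open ≡-Reasoning
      regroup : ∀ x y B → B * (x * 0ℤ + y * 1ℤ) + 0ℤ ≡ x * (B * 0ℤ) + y * (B * 1ℤ)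
      regroup = solve-∀
  atConv-digitSum ξ@(x α+ y) b (suc N) = begin
      sumFrom g 0 (suc (suc N))
    ≡⟨ sumFrom-snoc g 0 (suc N) ⟩
      sumFrom g 0 (suc N) + g (suc N)
    ≡⟨ cong (_+ g (suc N)) (atConv-digitSum ξ b N) ⟩
      x * + Sp + y * + Sq + + b (suc N) * (x * + p a (suc N) + y * + q a (suc N))
    ≡⟨ regroup x y (+ Sp) (+ Sq) (+ b (suc N)) (+ p a (suc N)) (+ q a (suc N)) ⟩
      x * (+ Sp + + b (suc N) * + p a (suc N)) + y * (+ Sq + + b (suc N) * + q a (suc N))
    ≡⟨ sym (cong₂ (λ u v → x * u + y * v) (cast Sp (p a (suc N))) (cast Sq (q a (suc N)))) ⟩
      x * + (Sp ℕ.+ b (suc N) ℕ.* p a (suc N)) + y * + (Sq ℕ.+ b (suc N) ℕ.* q a (suc N)) ∎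
    where
      open ≡-Reasoning
      g : ℕ → ℤ
      g k = + b k * atConv a ξ k
      Sp = sumTo (λ k → b k ℕ.* p a k) N
      Sq = sumTo (λ k → b k ℕ.* q a k) N
      cast : ∀ S c → + (S ℕ.+ b (suc N) ℕ.* c) ≡ + S + + b (suc N) * + c
      cast S c = trans (ℤₚ.pos-+ S _) (cong (λ v → + S + v) (ℤₚ.pos-* (b (suc N)) c))
      regroup : ∀ x y Sp Sq B P Q → x * Sp + y * Sq + B * (x * P + y * Q) ≡ x * (Sp + B * P) + y * (Sq + B * Q)
      regroup = solve-∀

  recurrence-pos : (u : ℕ → ℤ) → (∀ j → u (suc (suc j)) ≡ + a (suc (suc j)) * u (suc j) + u j) →
                   ∀ j → 0ℤ < u j → 0ℤ < u (suc j) → Eventually (λ i → 0ℤ < u i)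
  recurrence-pos u u-rec j 0<uⱼ 0<uⱼ₊₁ = after j λ i j≤i → proj₁ (consecutive (ℕₚ.≤⇒≤′ j≤i))
    where
      consecutive : ∀ {i} → j ≤′ i → 0ℤ < u i × 0ℤ < u (suc i)
      consecutive ≤′-refl = 0<uⱼ , 0<uⱼ₊₁
      consecutive {suc i} (≤′-step j≤i) with consecutive j≤i
      ... | 0<uᵢ , 0<uᵢ₊₁ = 0<uᵢ₊₁ , subst (0ℤ <_) (sym (u-rec i))
        (nonNeg+pos⇒pos (nonNeg*nonNeg⇒nonNeg (+≤+ (z≤n {a (suc (suc i))})) (ℤₚ.<⇒≤ 0<uᵢ₊₁)) 0<uᵢ)

  signed-rec : (u : ℕ → ℤ) → (∀ j → u (suc (suc j)) ≡ + a (suc (suc j)) * u (suc j) + u j) →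
               ∀ k → sign k * u k ≡ + a (suc (suc k)) * (sign (suc k) * u (suc k)) + sign (suc (suc k)) * u (suc (suc k))
  signed-rec u u-rec k = sym (begin
      + a (suc (suc k)) * (- sign k * u (suc k)) + - - sign k * u (suc (suc k))
    ≡⟨ cong (λ v → + a (suc (suc k)) * (- sign k * u (suc k)) + - - sign k * v) (u-rec k) ⟩
      + a (suc (suc k)) * (- sign k * u (suc k)) + - - sign k * (+ a (suc (suc k)) * u (suc k) + u k)
    ≡⟨ cancel (+ a (suc (suc k))) (sign k) (u k) (u (suc k)) ⟩
      sign k * u k ∎)
    where
      open ≡-Reasoning
      cancel : ∀ A s u₀ u₁ → A * (- s * u₁) + - - s * (A * u₁ + u₀) ≡ s * u₀
      cancel = solve-∀

  module _ (cf : CFSeq a) where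

    q-pos : ∀ k → 0ℤ < + q a k
    q-pos k = +<+ (1≤q k)
      where
        1≤q : ∀ k → 1 ℕ.≤ q a k
        1≤q zero          = s≤s z≤n
        1≤q (suc zero)    = cf 0
        1≤q (suc (suc k)) = ℕₚ.≤-trans (1≤q k) (ℕₚ.m≤n+m (q a k) _)

    atConv-next-pos : ∀ ξ j → 0ℤ < atConv a ξ j → 0ℤ < coef ξ * sign j → 0ℤ < atConv a ξ (suc j)
    atConv-next-pos ξ j 0<Fⱼ 0<xs = ℤₚ.*-cancelʳ-<-nonNeg (+ q a j) (subst (0ℤ <_) (sym (atConv-cross ξ j))
      (pos+nonNeg⇒pos (pos*pos⇒pos 0<Fⱼ (q-pos (suc j))) (ℤₚ.<⇒≤ 0<xs)))

    -- Pos reads off the sign at one suitable convergent; by the determinant identity that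
    -- sign then persists at every later convergent.
    pos⇒eventually : ∀ ξ → Pos a ξ → Eventually (λ i → 0ℤ < atConv a ξ i)
    pos⇒eventually (x α+ y) (inj₁ (refl , 0<y)) = after 0 λ i _ →
      subst (0ℤ <_) (sym (ℤₚ.+-identityˡ (y * + q a i))) (pos*pos⇒pos 0<y (q-pos i))
    pos⇒eventually ξ@(x α+ y) (inj₂ (inj₁ (0<x , k , 0<F))) =
      recurrence-pos (atConv a ξ) (atConv-rec ξ) (2 ℕ.* k) 0<F (atConv-next-pos ξ (2 ℕ.* k) 0<F
        (subst (0ℤ <_) (sym (trans (cong (x *_) (sign-even k)) (ℤₚ.*-identityʳ x))) 0<x))
    pos⇒eventually ξ@(x α+ y) (inj₂ (inj₂ (x<0 , k , 0<F))) =
      recurrence-pos (atConv a ξ) (atConv-rec ξ) (suc (2 ℕ.* k)) 0<F (atConv-next-pos ξ (suc (2 ℕ.* k)) 0<F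
        (subst (0ℤ <_) (sym (trans (cong (λ s → x * - s) (sign-even k)) (x*-1≡-x x))) (ℤₚ.neg-mono-< x<0)))
      where x*-1≡-x : ∀ x → x * -1ℤ ≡ - x
            x*-1≡-x = solve-∀

    eventually⇒pos : ∀ ξ → Eventually (λ i → 0ℤ < atConv a ξ i) → Pos a ξ
    eventually⇒pos ((+ zero) α+ y) (after K pos) = inj₁ (refl ,
      ℤₚ.*-cancelʳ-<-nonNeg (+ q a K) (subst (0ℤ <_) (ℤₚ.+-identityˡ (y * + q a K)) (pos K ℕₚ.≤-refl)))
    eventually⇒pos (+[1+ x ] α+ y) (after K pos) =
      inj₂ (inj₁ (+<+ (s≤s z≤n) , K , pos (2 ℕ.* K) (ℕₚ.m≤m+n K _)))
    eventually⇒pos (-[1+ x ] α+ y) (after K pos) =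
      inj₂ (inj₂ (-<+ , K , pos (suc (2 ℕ.* K)) (ℕₚ.m≤n⇒m≤1+n (ℕₚ.m≤m+n K _))))

    <[]⇒eventually< : ∀ ξ η → ξ <[ a ] η → Eventually (λ i → atConv a ξ i < atConv a η i)
    <[]⇒eventually< ξ η ξ<η =
      eventually-map (λ {i} → 0<j-i⇒i<j ∘ subst (0ℤ <_) (atConv-⊖ η ξ i)) (pos⇒eventually (η ⊖ ξ) ξ<η)

    eventually<⇒<[] : ∀ ξ η → Eventually (λ i → atConv a ξ i < atConv a η i) → ξ <[ a ] η
    eventually<⇒<[] ξ η ξ<η =
      eventually⇒pos (η ⊖ ξ) (eventually-map (λ {i} → subst (0ℤ <_) (sym (atConv-⊖ η ξ i)) ∘ i<j⇒0<j-i) ξ<η)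

    <[]-asym : ∀ ξ η → ξ <[ a ] η → η <[ a ] ξ → ⊥
    <[]-asym ξ η ξ<η η<ξ =
      let _ , ξᵢ<ηᵢ , ηᵢ<ξᵢ = eventually⇒∃ (eventually-zip (<[]⇒eventually< ξ η ξ<η) (<[]⇒eventually< η ξ η<ξ))
      in ℤₚ.<-asym ξᵢ<ηᵢ ηᵢ<ξᵢ

    isFloor-unique : ∀ ξ m c → IsFloor a ξ m →
      Eventually (λ i → c * + q a i < atConv a ξ i × atConv a ξ i < (c + 1ℤ) * + q a i) → m ≡ c
    isFloor-unique ξ m c (m<ξ , ξ<m+1) c<ξ<c+1 =
      let i , (m<ξᵢ , ξᵢ<m+1) , (c<ξᵢ , ξᵢ<c+1) =
            eventually⇒∃ (eventually-zip (eventually-zip (<[]⇒eventually< (const m) ξ m<ξ)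
                                                         (<[]⇒eventually< ξ (const (m + 1ℤ)) ξ<m+1)) c<ξ<c+1)
      in <+1∧>-1⇒≡
        (ℤₚ.*-cancelʳ-<-nonNeg (+ q a i) (ℤₚ.<-trans (subst (_< atConv a ξ i) (atConv-const m i) m<ξᵢ) ξᵢ<c+1))
        (ℤₚ.*-cancelʳ-<-nonNeg (+ q a i) (ℤₚ.<-trans c<ξᵢ (subst (atConv a ξ i <_) (atConv-const (m + 1ℤ) i) ξᵢ<m+1)))

    isMin-≮ˡ : ∀ A B X → IsMin a A B X → A <[ a ] B → A <[ a ] X → ⊥
    isMin-≮ˡ A B X (inj₁ (_ , X≤A , _)) _   A<X = X≤A A<X
    isMin-≮ˡ A B X (inj₂ (B<A , _))     A<B _   = <[]-asym A B A<B B<A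

    isMin-≮ʳ : ∀ A B X → IsMin a A B X → B <[ a ] A → B <[ a ] X → ⊥
    isMin-≮ʳ A B X (inj₁ (A≤B , _))     B<A _   = A≤B B<A
    isMin-≮ʳ A B X (inj₂ (_ , X≤B , _)) _   B<X = X≤B B<X

-- t stands for the remainders t_k = (-1)^k (q_k p_{r+1} - p_k q_{r+1}) of level r+1;
-- only their recurrence and their signs at r and r+1 are used.
module Remainders (a : ℕ → ℕ) (cf : CFSeq a) (t : ℕ → ℤ)
  (t-rec : ∀ k → t k ≡ + a (suc (suc k)) * t (suc k) + t (suc (suc k)))
  (r : ℕ) (0<tᵣ : 0ℤ ℤ.< t r) (0≤tᵣ₊₁ : 0ℤ ℤ.≤ t (suc r)) where

  open import Data.Integer using (_<_; _≤_)
  open ℤₚ.≤-Reasoning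

  t-pos : ∀ {k} → k ℕ.≤ r → 0ℤ < t k
  t-pos k≤r = proj₁ (consecutive (ℕₚ.≤⇒≤‴ k≤r))
    where
      consecutive : ∀ {k} → k ≤‴ r → 0ℤ < t k × 0ℤ ≤ t (suc k)
      consecutive ≤‴-refl = 0<tᵣ , 0≤tᵣ₊₁
      consecutive {k} (≤‴-step k<r) with consecutive k<r
      ... | 0<tₖ₊₁ , 0≤tₖ₊₂ = subst (0ℤ <_) (sym (t-rec k))
        (pos+nonNeg⇒pos (pos*pos⇒pos (+<+ (cf (suc k))) 0<tₖ₊₁) 0≤tₖ₊₂) , ℤₚ.<⇒≤ 0<tₖ₊₁

  t-nonNeg : ∀ {k} → k ℕ.≤ suc r → 0ℤ ≤ t k
  t-nonNeg k≤r+1 with ℕₚ.m≤n⇒m<n∨m≡n k≤r+1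
  ... | inj₁ k<r+1 = ℤₚ.<⇒≤ (t-pos (ℕₚ.≤-pred k<r+1))
  ... | inj₂ refl  = 0≤tᵣ₊₁

  scale-≤ : ∀ {c d k} → c ℕ.≤ d → k ℕ.≤ r → + c * t k ≤ + d * t k
  scale-≤ {k = k} c≤d k≤r = ℤₚ.*-monoʳ-≤-nonNeg (t k) {{ℤ.nonNegative (ℤₚ.<⇒≤ (t-pos k≤r))}} (+≤+ c≤d)

  digit-bound : ∀ {j} c → c ℕ.≤ a (suc (suc j)) → suc j ℕ.≤ r → + c * t (suc j) + t (suc (suc j)) ≤ t j
  digit-bound {j} c c≤a j<r = begin
    + c * t (suc j) + t (suc (suc j))                 ≤⟨ ℤₚ.+-monoˡ-≤ (t (suc (suc j))) (scale-≤ c≤a j<r) ⟩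
    + a (suc (suc j)) * t (suc j) + t (suc (suc j))   ≡⟨ sym (t-rec j) ⟩
    t j                                               ∎

  t-step : ∀ {k} → suc k ℕ.≤ r → t (suc k) ≤ t k
  t-step {k} k<r = begin
    t (suc k)                          ≤⟨ ℤₚ.i≤i+j (t (suc k)) (t (suc (suc k))) {{ℤ.nonNegative (t-nonNeg (s≤s k<r))}} ⟩
    t (suc k) + t (suc (suc k))        ≡⟨ cong (_+ t (suc (suc k))) (sym (ℤₚ.*-identityˡ (t (suc k)))) ⟩
    1ℤ * t (suc k) + t (suc (suc k))   ≤⟨ digit-bound 1 (cf (suc k)) k<r ⟩
    t k                                ∎

  t-antitone : ∀ {j k} → j ℕ.≤ k → k ℕ.≤ r → t k ≤ t j
  t-antitone {j} j≤k = go (ℕₚ.≤⇒≤′ j≤k)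
    where
      go : ∀ {k} → j ≤′ k → k ℕ.≤ r → t k ≤ t j
      go ≤′-refl       _   = ℤₚ.≤-refl
      go (≤′-step j≤k) k<r = ℤₚ.≤-trans (t-step k<r) (go j≤k (ℕₚ.<⇒≤ k<r))

  module Digits (b : ℕ → ℕ) (b-bound : ∀ k → b (suc k) ℕ.≤ a (suc (suc k))) where

    altDigitSum : ℕ → ℕ → ℤ
    altDigitSum = alt (λ k → + b k * t k)

    altDigitSum-bounds : ∀ f j → suc (suc j) ℕ.+ f ℕ.≤ r →
      - t (suc j) < altDigitSum (suc j) f × altDigitSum (suc j) f < + b (suc j) * t (suc j) + t (suc (suc j))
    altDigitSum-bounds zero j j+2≤r =
      ℤₚ.neg-mono-< (t-pos (ℕₚ.<⇒≤ j+2≤r′)) ,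
      nonNeg+pos⇒pos (scale-≤ {d = b (suc j)} z≤n (ℕₚ.<⇒≤ j+2≤r′)) (t-pos j+2≤r′)
      where j+2≤r′ = ℕₚ.m+n≤o⇒m≤o (suc (suc j)) j+2≤r
    altDigitSum-bounds (suc f) j j+2+f+1≤r
      with altDigitSum-bounds f (suc j) (subst (ℕ._≤ r) (ℕₚ.+-suc _ f) j+2+f+1≤r)
    ... | lower , upper = lower′ , ℤₚ.+-monoʳ-< bₜ (neg-flip-< lower)
      where
        bₜ = + b (suc j) * t (suc j)
        rest = altDigitSum (suc (suc j)) f
        j+2≤r = ℕₚ.m+n≤o⇒m≤o (suc (suc j)) j+2+f+1≤r
        lower′ : - t (suc j) < bₜ - rest
        lower′ = begin-strict
          - t (suc j)   <⟨ ℤₚ.neg-mono-< (ℤₚ.<-≤-trans upper (digit-bound (b (suc (suc j))) (b-bound (suc j)) j+2≤r)) ⟩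
          - rest        ≤⟨ ℤₚ.i≤j+i (- rest) bₜ {{ℤ.nonNegative (scale-≤ {d = b (suc j)} z≤n (ℕₚ.<⇒≤ j+2≤r))}} ⟩
          bₜ - rest     ∎

    altDigitSum-< : ∀ f j → suc (suc j) ℕ.+ f ℕ.≤ r → altDigitSum (suc j) f < t j
    altDigitSum-< f j j+2+f≤r = ℤₚ.<-≤-trans (proj₂ (altDigitSum-bounds f j j+2+f≤r))
      (digit-bound (b (suc j)) (b-bound j) (ℕₚ.<⇒≤ (ℕₚ.m+n≤o⇒m≤o (suc (suc j)) j+2+f≤r)))

    leading-altDigitSum-< : ∀ {L} f → suc (suc (suc L)) ℕ.+ f ℕ.≤ r → altDigitSum (suc L) (suc f) < t L
    leading-altDigitSum-< {L} f L+3+f≤r =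
      altDigitSum-< (suc f) L (subst (ℕ._≤ r) (sym (ℕₚ.+-suc (suc (suc L)) f)) L+3+f≤r)

    altDigitSum-pos : ∀ {L} f → 1 ℕ.≤ b L → suc (suc L) ℕ.+ f ℕ.≤ r → 0ℤ < altDigitSum L (suc f)
    altDigitSum-pos {L} f 1≤bₗ L+2+f≤r = i<j⇒0<j-i (begin-strict
      altDigitSum (suc L) f   <⟨ altDigitSum-< f L L+2+f≤r ⟩
      t L                     ≡⟨ sym (ℤₚ.*-identityˡ (t L)) ⟩
      1ℤ * t L                ≤⟨ scale-≤ 1≤bₗ (ℕₚ.m+n≤o⇒m≤o L (ℕₚ.m+n≤o⇒n≤o 2 L+2+f≤r)) ⟩
      + b L * t L             ∎)

    -- The Ostrowski condition b_{L+1} = a_{L+2} ⇒ b_L = 0 buys the extra t_{L+1}.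
    altDigitSum-+tail-< : ∀ {L} f → 1 ℕ.≤ b L → (b (suc L) ≡ a (suc (suc L)) → b L ≡ 0) →
                          suc (suc L) ℕ.+ f ℕ.≤ r → altDigitSum (suc L) f + t (suc L) < t L
    altDigitSum-+tail-< {L} f 1≤bₗ valid L+2+f≤r = begin-strict
      altDigitSum (suc L) f + t (suc L)                       <⟨ ℤₚ.+-monoˡ-< (t (suc L)) (proj₂ (altDigitSum-bounds f L L+2+f≤r)) ⟩
      + b (suc L) * t (suc L) + t (suc (suc L)) + t (suc L)   ≡⟨ regroup (+ b (suc L)) (t (suc L)) (t (suc (suc L))) ⟩
      (1ℤ + + b (suc L)) * t (suc L) + t (suc (suc L))        ≤⟨ digit-bound (suc (b (suc L))) bₗ₊₁<a
                                                                  (ℕₚ.<⇒≤ (ℕₚ.m+n≤o⇒m≤o (suc (suc L)) L+2+f≤r)) ⟩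
      t L                                                     ∎
      where
        regroup : ∀ B T₁ T₂ → B * T₁ + T₂ + T₁ ≡ (1ℤ + B) * T₁ + T₂
        regroup = solve-∀
        bₗ₊₁<a : b (suc L) ℕ.< a (suc (suc L))
        bₗ₊₁<a = ℕₚ.≤∧≢⇒< (b-bound L) λ bₗ₊₁≡a → ℕₚ.<⇒≢ 1≤bₗ (sym (valid bₗ₊₁≡a))

    -- a_1 t_0 + t_1 is the denominator q_{r+1} of the level.
    altDigitSum-half : ∀ {L} f → 1 ℕ.≤ L → (L ≡ 1 → + 2 * t 0 < + a 1 * t 0 + t 1) →
                       suc (suc L) ℕ.+ f ℕ.≤ r → + 2 * altDigitSum L (suc f) < + a 1 * t 0 + t 1
    altDigitSum-half {1} f _ 2t₀<q L+2+f≤r =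
      ℤₚ.<-trans (ℤₚ.*-monoˡ-<-pos (+ 2) (leading-altDigitSum-< f L+2+f≤r)) (2t₀<q refl)
    altDigitSum-half {suc (suc L)} f _ _ L+4+f≤r = begin-strict
      + 2 * altDigitSum (suc (suc L)) (suc f)   <⟨ ℤₚ.*-monoˡ-<-pos (+ 2)
                                                     (ℤₚ.<-≤-trans (leading-altDigitSum-< f L+4+f≤r) (t-antitone (s≤s z≤n) L+1≤r)) ⟩
      + 2 * t 1                                 ≡⟨ two-times (t 1) ⟩
      t 1 + t 1                                 ≤⟨ ℤₚ.+-monoˡ-≤ (t 1) (t-step (ℕₚ.≤-trans (s≤s z≤n) L+1≤r)) ⟩
      t 0 + t 1                                 ≡⟨ cong (_+ t 1) (sym (ℤₚ.*-identityˡ (t 0))) ⟩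
      1ℤ * t 0 + t 1                            ≤⟨ ℤₚ.+-monoˡ-≤ (t 1) (scale-≤ (cf 0) z≤n) ⟩
      + a 1 * t 0 + t 1                         ∎
      where
        two-times : ∀ x → + 2 * x ≡ x + x
        two-times = solve-∀
        L+1≤r = ℕₚ.m+n≤o⇒m≤o (suc L) (ℕₚ.m+n≤o⇒n≤o 3 L+4+f≤r)

  module _ (b  : ℕ → ℕ) (b-bound  : ∀ k → b  (suc k) ℕ.≤ a (suc (suc k)))
           (b′ : ℕ → ℕ) (b′-bound : ∀ k → b′ (suc k) ℕ.≤ a (suc (suc k))) where
    open Digits b b-bound
    open Digits b′ b′-bound using () renaming (altDigitSum to altDigitSum′; altDigitSum-+tail-< to altDigitSum′-+tail-<)

    altDigitSum-mono : ∀ {L} f f′ → b L ℕ.< b′ L → (b′ (suc L) ≡ a (suc (suc L)) → b′ L ≡ 0) →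
                       suc (suc L) ℕ.+ f ℕ.≤ r → suc (suc L) ℕ.+ f′ ℕ.≤ r →
                       altDigitSum L (suc f) < altDigitSum′ L (suc f′)
    altDigitSum-mono {L} f f′ bₗ<b′ₗ valid′ L+2+f≤r L+2+f′≤r = begin-strict
      + b L * t L - altDigitSum (suc L) f            <⟨ ℤₚ.+-monoʳ-< (+ b L * t L) (neg-flip-< (proj₁ (altDigitSum-bounds f L L+2+f≤r))) ⟩
      + b L * t L + t (suc L)                        <⟨ ℤₚ.+-monoʳ-< (+ b L * t L)
                                                          (i+j<k⇒j<k-i (altDigitSum′-+tail-< f′ (ℕₚ.<-≤-trans (s≤s z≤n) bₗ<b′ₗ) valid′ L+2+f′≤r)) ⟩
      + b L * t L + (t L - altDigitSum′ (suc L) f′)  ≡⟨ regroup (+ b L) (t L) (altDigitSum′ (suc L) f′) ⟩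
      (1ℤ + + b L) * t L - altDigitSum′ (suc L) f′   ≤⟨ ℤₚ.+-monoˡ-≤ (- altDigitSum′ (suc L) f′)
                                                          (scale-≤ bₗ<b′ₗ (ℕₚ.m+n≤o⇒m≤o L (ℕₚ.m+n≤o⇒n≤o 2 L+2+f≤r))) ⟩
      + b′ L * t L - altDigitSum′ (suc L) f′         ∎
      where
        regroup : ∀ B T W → B * T + (T - W) ≡ (1ℤ + B) * T - W
        regroup = solve-∀

module _ (a : ℕ → ℕ) where

  -- p_i - q_i α; its value at p_k/q_k, times q_k, is q_k p_i - p_k q_i.
  convergentError : ℕ → Lin
  convergentError i = (- + q a i) α+ (+ p a i)

  remainder : ℕ → ℕ → ℤ
  remainder i k = sign k * atConv a (convergentError i) k

  remainder-rec : ∀ i k → remainder i k ≡ + a (suc (suc k)) * remainder i (suc k) + remainder i (suc (suc k))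
  remainder-rec i = signed-rec a (atConv a (convergentError i)) (atConv-rec a (convergentError i))

  remainder-self : ∀ i → remainder i i ≡ 0ℤ
  remainder-self i = cancel (sign i) (+ p a i) (+ q a i)
    where cancel : ∀ s P Q → s * (- Q * P + P * Q) ≡ 0ℤ
          cancel = solve-∀

  remainder-last : ∀ r → remainder (suc r) r ≡ 1ℤ
  remainder-last r = begin
    sign r * (- + q a (suc r) * + p a r + + p a (suc r) * + q a r)  ≡⟨ swap (sign r) (+ p a r) (+ p a (suc r)) (+ q a r) (+ q a (suc r)) ⟩
    sign r * (+ p a (suc r) * + q a r - + p a r * + q a (suc r))    ≡⟨ cong (sign r *_) (convergent-det a r) ⟩
    sign r * sign r                                                ≡⟨ sign-squared r ⟩
    1ℤ                                                             ∎
    where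
      open ≡-Reasoning
      swap : ∀ s p₀ p₁ q₀ q₁ → s * (- q₁ * p₀ + p₁ * q₀) ≡ s * (p₁ * q₀ - p₀ * q₁)
      swap = solve-∀

  remainder-zero : ∀ i → remainder i 0 ≡ + p a i
  remainder-zero i = simplify (+ p a i) (+ q a i)
    where simplify : ∀ P Q → 1ℤ * (- Q * 0ℤ + P * 1ℤ) ≡ P
          simplify = solve-∀

  remainder-denominator : ∀ i → + a 1 * remainder i 0 + remainder i 1 ≡ + q a i
  remainder-denominator i = simplify (+ a 1) (+ p a i) (+ q a i)
    where simplify : ∀ A P Q → A * (1ℤ * (- Q * 0ℤ + P * 1ℤ)) + -1ℤ * (- Q * 1ℤ + P * A) ≡ Q
          simplify = solve-∀

  ostrowski-identity : ∀ (b : ℕ → ℕ) N L f i → (∀ k → k ℕ.< L → b k ≡ 0) → L ℕ.+ f ≡ suc N →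
    + sumTo (λ k → b k ℕ.* q a k) N * + p a i - + sumTo (λ k → b k ℕ.* p a k) N * + q a i
      ≡ sign L * alt (λ k → + b k * remainder i k) L f
  ostrowski-identity b N L f i zeros L+f≡N+1 = begin
      + n * + p a i - + P * + q a i
    ≡⟨ regroup (+ n) (+ P) (+ p a i) (+ q a i) ⟩
      - + q a i * + P + + p a i * + n
    ≡⟨ sym (atConv-digitSum a (convergentError i) b N) ⟩
      sumFrom g 0 (suc N)
    ≡⟨ cong (sumFrom g 0) (sym L+f≡N+1) ⟩
      sumFrom g 0 (L ℕ.+ f)
    ≡⟨ sumFrom-skip-zeros g 0 L f (λ k k<L+0 → cong (λ c → + c * _) (zeros k (subst (k ℕ.<_) (ℕₚ.+-identityʳ L) k<L+0))) ⟩
      sumFrom g (L ℕ.+ 0) f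
    ≡⟨ cong (λ j → sumFrom g j f) (ℕₚ.+-identityʳ L) ⟩
      sumFrom g L f
    ≡⟨ sumFrom-alternating g (λ k → + b k * remainder i k) L f g≡ ⟩
      sign L * alt (λ k → + b k * remainder i k) L f ∎
    where
      open ≡-Reasoning
      n = sumTo (λ k → b k ℕ.* q a k) N
      P = sumTo (λ k → b k ℕ.* p a k) N
      g : ℕ → ℤ
      g k = + b k * atConv a (convergentError i) k
      regroup : ∀ n P p q → n * p - P * q ≡ - q * P + p * n
      regroup = solve-∀
      g≡ : ∀ k → g k ≡ sign k * (+ b k * remainder i k)
      g≡ k = begin
        + b k * e                        ≡⟨ cong (+ b k *_) (sym (ℤₚ.*-identityˡ e)) ⟩
        + b k * (1ℤ * e)                 ≡⟨ cong (λ s → + b k * (s * e)) (sym (sign-squared k)) ⟩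
        + b k * (sign k * sign k * e)    ≡⟨ regroup′ (+ b k) (sign k) e ⟩
        sign k * (+ b k * (sign k * e))  ∎
        where
          e = atConv a (convergentError i) k
          regroup′ : ∀ B s e → B * (s * s * e) ≡ s * (B * (s * e))
          regroup′ = solve-∀

module AtLevel (a : ℕ → ℕ) (cf : CFSeq a) (r : ℕ) =
  Remainders a cf (remainder a (suc r)) (remainder-rec a (suc r)) r
    (subst (0ℤ ℤ.<_) (sym (remainder-last a r)) (+<+ (s≤s z≤n)))
    (subst (0ℤ ℤ.≤_) (sym (remainder-self a (suc r))) (+≤+ z≤n))

module OstrowskiDigits (a : ℕ → ℕ) (cf : CFSeq a) (b : ℕ → ℕ) (N : ℕ)
  (b-vanishes : ∀ k → N ℕ.< k → b k ≡ 0) (b-bound : ∀ k → b (suc k) ℕ.≤ a (suc (suc k)))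
  (L : ℕ) (L-lowest : K0 b L) where

  open import Data.Integer using (_<_; _≤_)

  n : ℕ
  n = sumTo (λ k → b k ℕ.* q a k) N

  P : ℤ
  P = + sumTo (λ k → b k ℕ.* p a k) N

  f : ℕ
  f = N ℕ.∸ L

  V : ℕ → ℤ
  V i = alt (λ k → + b k * remainder a i k) L (suc f)

  L≤N : L ℕ.≤ N
  L≤N = ℕₚ.≮⇒≥ λ N<L → ℕₚ.<⇒≢ (proj₁ L-lowest) (sym (b-vanishes L N<L))

  discrepancy : ∀ i → + n * + p a i - P * + q a i ≡ sign L * V i
  discrepancy i = ostrowski-identity a b N L (suc f) i (proj₂ L-lowest)
    (trans (ℕₚ.+-suc L f) (cong suc (ℕₚ.m+[n∸m]≡n L≤N)))

  room : ∀ {r} → suc (suc N) ℕ.≤ r → suc (suc L) ℕ.+ f ℕ.≤ r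
  room {r} = subst (ℕ._≤ r) (cong (suc ∘ suc) (sym (ℕₚ.m+[n∸m]≡n L≤N)))

  V-pos : Eventually (λ i → 0ℤ < V i)
  V-pos = eventually-shift (after (suc (suc N)) λ r N+2≤r →
    AtLevel.Digits.altDigitSum-pos a cf r b b-bound f (proj₁ L-lowest) (room N+2≤r))

  V-half : 1 ℕ.≤ L → Eventually (λ i → L ≡ 1 → + 2 * + p a i < + q a i) →
           Eventually (λ i → + 2 * V i < + q a i)
  V-half 1≤L = eventually-ap (eventually-shift (after (suc (suc N)) λ r N+2≤r 2p<q →
    subst (+ 2 * V (suc r) <_) (remainder-denominator a (suc r))
      (AtLevel.Digits.altDigitSum-half a cf r b b-bound f 1≤L
        (λ L≡1 → subst₂ (λ x y → + 2 * x < y) (sym (remainder-zero a (suc r))) (sym (remainder-denominator a (suc r)))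
                   (2p<q L≡1))
        (room N+2≤r))))

module OstrowskiComparison (a : ℕ → ℕ) (cf : CFSeq a)
  (b  : ℕ → ℕ) (N  : ℕ) (b-vanishes  : ∀ k → N  ℕ.< k → b  k ≡ 0) (b-bound  : ∀ k → b  (suc k) ℕ.≤ a (suc (suc k)))
  (b′ : ℕ → ℕ) (N′ : ℕ) (b′-vanishes : ∀ k → N′ ℕ.< k → b′ k ≡ 0) (b′-bound : ∀ k → b′ (suc k) ℕ.≤ a (suc (suc k)))
  (L : ℕ) (L-lowest : K0 b L) (L-lowest′ : K0 b′ L) where

  module D  = OstrowskiDigits a cf b  N  b-vanishes  b-bound  L L-lowest
  module D′ = OstrowskiDigits a cf b′ N′ b′-vanishes b′-bound L L-lowest′

  V-mono : b L ℕ.< b′ L → (b′ (suc L) ≡ a (suc (suc L)) → b′ L ≡ 0) → Eventually (λ i → D.V i ℤ.< D′.V i)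
  V-mono bₗ<b′ₗ valid′ = eventually-shift (after (suc (suc (N ℕ.⊔ N′))) λ r N⊔N′+2≤r →
    AtLevel.altDigitSum-mono a cf r b b-bound b′ b′-bound D.f D′.f bₗ<b′ₗ valid′
      (D.room  (ℕₚ.≤-trans (s≤s (s≤s (ℕₚ.m≤m⊔n N N′))) N⊔N′+2≤r))
      (D′.room (ℕₚ.≤-trans (s≤s (s≤s (ℕₚ.m≤n⊔m N N′))) N⊔N′+2≤r)))

module _ (a : ℕ → ℕ) where
  open import Data.Integer using (_<_; _≤_)

  -- At the convergent p_i/q_i, ξ equals c + U i / q_i.
  record Near (ξ : Lin) (c : ℤ) (U : ℕ → ℤ) : Set where
    constructor near
    field atConv≡ : ∀ i → atConv a ξ i ≡ c * + q a i + U i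

  InUnitGap : (ℕ → ℤ) → Set
  InUnitGap U = Eventually (λ i → 0ℤ < U i × U i < + q a i)

  InHalfGap : (ℕ → ℤ) → Set
  InHalfGap U = Eventually (λ i → 0ℤ < U i × + 2 * U i < + q a i)

  complement : (ℕ → ℤ) → ℕ → ℤ
  complement U i = + q a i - U i

  half⇒<complement : ∀ {U} → InHalfGap U → Eventually (λ i → U i < complement U i)
  half⇒<complement = eventually-map λ (_ , 2U<q) → 2i<j⇒i<j-i 2U<q

  half⇒inUnitGap : ∀ {U} → InHalfGap U → InUnitGap U
  half⇒inUnitGap = eventually-map λ (0<U , 2U<q) → 0<U , ℤₚ.<-trans (0<i⇒i<2i 0<U) 2U<q

  half⇒complement-inUnitGap : ∀ {U} → InHalfGap U → InUnitGap (complement U)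
  half⇒complement-inUnitGap = eventually-map λ (0<U , 2U<q) →
    i<j⇒0<j-i (ℤₚ.<-trans (0<i⇒i<2i 0<U) 2U<q) , 0<i⇒j-i<j 0<U

  atConv-frac : ∀ ξ {c U} → Near ξ c U → ∀ i → atConv a (frac ξ c) i ≡ U i
  atConv-frac ξ {c} {U} (near ξ≈c+U) i = begin
    atConv a (ξ ⊖ const c) i                ≡⟨ atConv-⊖ a ξ (const c) i ⟩
    atConv a ξ i - atConv a (const c) i     ≡⟨ cong₂ _-_ (ξ≈c+U i) (atConv-const a c i) ⟩
    c * + q a i + U i - c * + q a i         ≡⟨ cancel (c * + q a i) (U i) ⟩
    U i                                     ∎
    where
      open ≡-Reasoning
      cancel : ∀ x y → x + y - x ≡ y
      cancel = solve-∀

  atConv-ceilGap : ∀ ξ {c U} → Near ξ c U → ∀ i → atConv a (const (c + 1ℤ) ⊖ ξ) i ≡ complement U i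
  atConv-ceilGap ξ {c} {U} (near ξ≈c+U) i = begin
    atConv a (const (c + 1ℤ) ⊖ ξ) i                ≡⟨ atConv-⊖ a (const (c + 1ℤ)) ξ i ⟩
    atConv a (const (c + 1ℤ)) i - atConv a ξ i     ≡⟨ cong₂ _-_ (atConv-const a (c + 1ℤ) i) (ξ≈c+U i) ⟩
    (c + 1ℤ) * + q a i - (c * + q a i + U i)       ≡⟨ cancel c (+ q a i) (U i) ⟩
    + q a i - U i                                  ∎
    where
      open ≡-Reasoning
      cancel : ∀ c Q U → (c + 1ℤ) * Q - (c * Q + U) ≡ Q - U
      cancel = solve-∀

  near-nα : ∀ n P {U} → (∀ i → + n * + p a i - P * + q a i ≡ U i) → Near (nα n) P U
  near-nα n P {U} n≈P+U = near λ i → begin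
    atConv a (nα n) i                             ≡⟨ atConv-nα a n i ⟩
    + n * + p a i                                 ≡⟨ shift (+ n * + p a i) (P * + q a i) ⟩
    P * + q a i + (+ n * + p a i - P * + q a i)   ≡⟨ cong (λ x → P * + q a i + x) (n≈P+U i) ⟩
    P * + q a i + U i                             ∎
    where
      open ≡-Reasoning
      shift : ∀ x y → x ≡ y + (x - y)
      shift = solve-∀

  near-sideArg : ∀ s {ξ c U} → Near ξ c U → Near (sideArg s ξ) (sideSign s * c) (λ i → sideSign s * U i)
  near-sideArg s {ξ} {c} {U} (near ξ≈c+U) = near λ i → begin
    atConv a (sideArg s ξ) i                     ≡⟨ atConv-sideArg a s ξ i ⟩
    sideSign s * atConv a ξ i                    ≡⟨ cong (sideSign s *_) (ξ≈c+U i) ⟩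
    sideSign s * (c * + q a i + U i)             ≡⟨ distrib (sideSign s) c (+ q a i) (U i) ⟩
    sideSign s * c * + q a i + sideSign s * U i  ∎
    where
      open ≡-Reasoning
      distrib : ∀ σ c Q U → σ * (c * Q + U) ≡ σ * c * Q + σ * U
      distrib = solve-∀

  near-cong : ∀ {ξ c U U′} → (∀ i → U i ≡ U′ i) → Near ξ c U → Near ξ c U′
  near-cong {c = c} U≡U′ (near ξ≈c+U) = near λ i → trans (ξ≈c+U i) (cong (λ x → c * + q a i + x) (U≡U′ i))

  near-borrow : ∀ {ξ c U} → Near ξ c (λ i → - U i) → Near ξ (c - 1ℤ) (complement U)
  near-borrow {c = c} {U} (near ξ≈c-U) = near λ i → trans (ξ≈c-U i) (borrow c (+ q a i) (U i))
    where borrow : ∀ c Q U → c * Q + - U ≡ (c - 1ℤ) * Q + (Q - U)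
          borrow = solve-∀

  module _ (cf : CFSeq a) where

    floor-near : ∀ ξ m {c U} → IsFloor a ξ m → Near ξ c U → InUnitGap U → m ≡ c
    floor-near ξ m {c} {U} ⌊ξ⌋≡m (near ξ≈c+U) U-gap = isFloor-unique a cf ξ m c ⌊ξ⌋≡m (eventually-map bracket U-gap)
      where
        bracket : ∀ {i} → 0ℤ < U i × U i < + q a i → c * + q a i < atConv a ξ i × atConv a ξ i < (c + 1ℤ) * + q a i
        bracket {i} (0<U , U<q) rewrite ξ≈c+U i =
          subst (_< c * + q a i + U i) (ℤₚ.+-identityʳ (c * + q a i)) (ℤₚ.+-monoʳ-< (c * + q a i) 0<U) ,
          subst (c * + q a i + U i <_) (distrib c (+ q a i)) (ℤₚ.+-monoʳ-< (c * + q a i) U<q)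
          where distrib : ∀ c Q → c * Q + Q ≡ (c + 1ℤ) * Q
                distrib = solve-∀

    frac-near : ∀ ξ m {c U} → IsFloor a ξ m → Near ξ c U → InUnitGap U → ∀ i → atConv a (frac ξ m) i ≡ U i
    frac-near ξ m ⌊ξ⌋≡m ξ≈c+U U-gap i =
      trans (cong (λ c → atConv a (frac ξ c) i) (floor-near ξ m ⌊ξ⌋≡m ξ≈c+U U-gap)) (atConv-frac ξ ξ≈c+U i)

    frac-<-frac : ∀ ξ ξ′ m m′ {c c′ U U′} → IsFloor a ξ m → IsFloor a ξ′ m′ → Near ξ c U → Near ξ′ c′ U′ →
                  InUnitGap U → InUnitGap U′ → Eventually (λ i → U i < U′ i) → frac ξ m <[ a ] frac ξ′ m′
    frac-<-frac ξ ξ′ m m′ ⌊ξ⌋≡m ⌊ξ′⌋≡m′ ξ≈c+U ξ′≈c′+U′ U-gap U′-gap =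
      eventually<⇒<[] a cf (frac ξ m) (frac ξ′ m′) ∘ eventually-map λ {i} →
        subst₂ _<_ (sym (frac-near ξ m ⌊ξ⌋≡m ξ≈c+U U-gap i)) (sym (frac-near ξ′ m′ ⌊ξ′⌋≡m′ ξ′≈c′+U′ U′-gap i))

    -- Within 1/2 of an integer, ‖ξ‖ is the distance to that integer, never the one across.
    isDist-¬far-just-above : ∀ ξ mn X {c U} → IsFloor a ξ mn → IsDist a ξ mn X → Near ξ c U → InHalfGap U →
                    (∀ i → atConv a X i ≡ complement U i) → ⊥
    isDist-¬far-just-above ξ mn X {c} {U} ⌊ξ⌋≡mn ‖ξ‖≡X ξ≈c+U U-half X≈q-U =
      isMin-≮ˡ a cf (frac ξ c) (const (c + 1ℤ) ⊖ ξ) X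
        (subst (λ m → IsDist a ξ m X) (floor-near ξ mn ⌊ξ⌋≡mn ξ≈c+U (half⇒inUnitGap U-half)) ‖ξ‖≡X)
      (eventually<⇒<[] a cf (frac ξ c) (const (c + 1ℤ) ⊖ ξ)
        (eventually-map (λ {i} → subst₂ _<_ (sym (atConv-frac ξ ξ≈c+U i)) (sym (atConv-ceilGap ξ ξ≈c+U i))) U<q-U))
      (eventually<⇒<[] a cf (frac ξ c) X
        (eventually-map (λ {i} → subst₂ _<_ (sym (atConv-frac ξ ξ≈c+U i)) (sym (X≈q-U i))) U<q-U))
      where U<q-U = half⇒<complement U-half

    isDist-¬far-just-below : ∀ ξ mn X {c U} → IsFloor a ξ mn → IsDist a ξ mn X → Near ξ c (complement U) → InHalfGap U →
                    (∀ i → atConv a X i ≡ complement U i) → ⊥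
    isDist-¬far-just-below ξ mn X {c} {U} ⌊ξ⌋≡mn ‖ξ‖≡X ξ≈c+q-U U-half X≈q-U =
      isMin-≮ʳ a cf (frac ξ c) (const (c + 1ℤ) ⊖ ξ) X
        (subst (λ m → IsDist a ξ m X) (floor-near ξ mn ⌊ξ⌋≡mn ξ≈c+q-U (half⇒complement-inUnitGap U-half)) ‖ξ‖≡X)
      (eventually<⇒<[] a cf (const (c + 1ℤ) ⊖ ξ) (frac ξ c)
        (eventually-map (λ {i} → subst₂ _<_ (sym (B≈U i)) (sym (atConv-frac ξ ξ≈c+q-U i))) U<q-U))
      (eventually<⇒<[] a cf (const (c + 1ℤ) ⊖ ξ) X
        (eventually-map (λ {i} → subst₂ _<_ (sym (B≈U i)) (sym (X≈q-U i))) U<q-U))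
      where
        U<q-U = half⇒<complement U-half
        B≈U : ∀ i → atConv a (const (c + 1ℤ) ⊖ ξ) i ≡ U i
        B≈U i = trans (atConv-ceilGap ξ ξ≈c+q-U i) (cancel (+ q a i) (U i))
          where cancel : ∀ Q U → Q - (Q - U) ≡ U
                cancel = solve-∀

    twoα<1⇒2p<q : ((+ 2) α+ (+ 0)) <[ a ] ((+ 0) α+ (+ 1)) → Eventually (λ i → + 2 * + p a i < + q a i)
    twoα<1⇒2p<q 2α<1 = eventually-map (λ {i} → subst₂ _<_ (simplifyˡ (+ p a i) (+ q a i)) (simplifyʳ (+ p a i) (+ q a i)))
      (<[]⇒eventually< a cf ((+ 2) α+ (+ 0)) ((+ 0) α+ (+ 1)) 2α<1)
      where
        simplifyˡ : ∀ P Q → + 2 * P + + 0 * Q ≡ + 2 * P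
        simplifyˡ = solve-∀
        simplifyʳ : ∀ P Q → + 0 * P + + 1 * Q ≡ Q
        simplifyʳ = solve-∀

    module SideComparison (n n′ : ℕ) (P P′ : ℤ) (V V′ : ℕ → ℤ) (ε : ℤ)
      (discrepancy  : ∀ i → + n  * + p a i - P  * + q a i ≡ ε * V  i)
      (discrepancy′ : ∀ i → + n′ * + p a i - P′ * + q a i ≡ ε * V′ i)
      (V-half : InHalfGap V) (V′-half : InHalfGap V′) where

      near-side : ∀ s k Q W → ε ≡ sideSign s → (∀ i → + k * + p a i - Q * + q a i ≡ ε * W i) →
                  Near (sideArg s (nα k)) (sideSign s * Q) W
      near-side s k Q W ε≡σ k≈Q+εW =
        near-cong (λ i → trans (cong (λ e → sideSign s * (e * W i)) ε≡σ) (sideSign-cancel s (W i)))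
                  (near-sideArg s (near-nα k Q k≈Q+εW))

      near-opposite : ∀ s → ε ≡ - sideSign s → Near (sideArg s (nα n)) (sideSign s * P - 1ℤ) (complement V)
      near-opposite s ε≡-σ = near-borrow
        (near-cong (λ i → trans (cong (λ e → sideSign s * (e * V i)) ε≡-σ) (sideSign-flip s (V i)))
                   (near-sideArg s (near-nα n P discrepancy)))

      matched : ∀ s m m′ → IsFloor a (sideArg s (nα n)) m → IsFloor a (sideArg s (nα n′)) m′ →
                Eventually (λ i → V i < V′ i) → ε ≡ sideSign s → sideVal s (nα n) m <[ a ] sideVal s (nα n′) m′
      matched s m m′ ⌊±nα⌋≡m ⌊±n′α⌋≡m′ V<V′ ε≡σ =
        frac-<-frac (sideArg s (nα n)) (sideArg s (nα n′)) m m′ ⌊±nα⌋≡m ⌊±n′α⌋≡m′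
          (near-side s n P V ε≡σ discrepancy) (near-side s n′ P′ V′ ε≡σ discrepancy′)
          (half⇒inUnitGap V-half) (half⇒inUnitGap V′-half) V<V′

      mismatched : ∀ s m mn → IsFloor a (sideArg s (nα n)) m → IsFloor a (nα n) mn →
                   IsDist a (nα n) mn (sideVal s (nα n) m) → ε ≡ - sideSign s → ⊥
      mismatched left m mn ⌊nα⌋≡m ⌊nα⌋≡mn ‖nα‖≡ ε≡-1 =
        isDist-¬far-just-below (nα n) mn (frac (nα n) m) ⌊nα⌋≡mn ‖nα‖≡ (near-opposite left ε≡-1) V-half
          (frac-near (nα n) m ⌊nα⌋≡m (near-opposite left ε≡-1) (half⇒complement-inUnitGap V-half))
      mismatched right m mn ⌊-nα⌋≡m ⌊nα⌋≡mn ‖nα‖≡ ε≡1 =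
        isDist-¬far-just-above (nα n) mn (frac (neg (nα n)) m) ⌊nα⌋≡mn ‖nα‖≡
          (near-cong (λ i → trans (cong (_* V i) ε≡1) (ℤₚ.*-identityˡ (V i))) (near-nα n P discrepancy)) V-half
          (frac-near (neg (nα n)) m ⌊-nα⌋≡m (near-opposite right ε≡1) (half⇒complement-inUnitGap V-half))

open import Data.Nat using (_≤_; _<_)

halving-condition : ∀ a → CFSeq a → ∀ L → (2 ≤ L ⊎ (1 ≤ L × ((+ 2) α+ (+ 0)) <[ a ] ((+ 0) α+ (+ 1)))) →
                    1 ≤ L × Eventually (λ i → L ≡ 1 → + 2 * + p a i ℤ.< + q a i)
halving-condition a cf L (inj₁ 2≤L)          = ℕₚ.<⇒≤ 2≤L , after 0 λ { _ _ refl → ⊥-elim (ℕₚ.<-irrefl refl 2≤L) }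
halving-condition a cf L (inj₂ (1≤L , 2α<1)) = 1≤L , eventually-map (λ 2p<q _ → 2p<q) (twoα<1⇒2p<q a cf 2α<1)

lemma5p7 : (a : ℕ → ℕ) → CFSeq a →
    (n n' L : ℕ) → 1 ≤ n → 1 ≤ n' →
    (b b' : ℕ → ℕ) → Ostrowski a n b → Ostrowski a n' b' →
    K0 b L → K0 b' L →
    (2 ≤ L ⊎ (1 ≤ L × ((+ 2) α+ (+ 0)) <[ a ] ((+ 0) α+ (+ 1)))) →
    (s : Side) → (m m' mn : ℤ) →
    IsFloor a (sideArg s (nα n)) m → IsFloor a (sideArg s (nα n')) m' →
    IsFloor a (nα n) mn → IsDist a (nα n) mn (sideVal s (nα n) m) →
    b L < b' L →
    sideVal s (nα n) m <[ a ] sideVal s (nα n') m'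
lemma5p7 a cf _ _ L _ _ b b′ ((N , b-vanishes , refl) , _ , b-bound , _) ((N′ , b′-vanishes , refl) , _ , b′-bound , valid′)
         L-lowest L-lowest′ halving s m m′ mn ⌊±nα⌋≡m ⌊±n′α⌋≡m′ ⌊nα⌋≡mn ‖nα‖≡ bₗ<b′ₗ =
  [ matched s m m′ ⌊±nα⌋≡m ⌊±n′α⌋≡m′ (V-mono bₗ<b′ₗ (valid′ L))
  , (λ mismatch → ⊥-elim (mismatched s m mn ⌊±nα⌋≡m ⌊nα⌋≡mn ‖nα‖≡ mismatch))
  ]′ (sign-vs-side L s)
  where
    open OstrowskiComparison a cf b N b-vanishes b-bound b′ N′ b′-vanishes b′-bound L L-lowest L-lowest′
    1≤L = proj₁ (halving-condition a cf L halving)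
    2p<q = proj₂ (halving-condition a cf L halving)
    open SideComparison a cf D.n D′.n D.P D′.P D.V D′.V (sign L) D.discrepancy D′.discrepancy
      (eventually-zip D.V-pos (D.V-half 1≤L 2p<q)) (eventually-zip D′.V-pos (D′.V-half 1≤L 2p<q))
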